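{- Let $e,n\in\mathbb{N}$ with $e<\binom n2$. Let $k=k(n,e)$, $\bm a^*=\bm a^*(n,e)$, $m^*=m^*(n,e)$, $k^+=k(n,e+1)$ and $\bm a^+=\bm a^*(n,e+1)$. Then: (i) if $m^*>0$, then $k^+=k$ and $\bm a^+=\bm a^*$; (ii) if $m^*=0$ and $a_1^*\ge a_k^*+2$, then $k^+=k$, $a_k^+=a_k^*+1$, and $(a_1^+,\dots,a_{k-1}^+)$ is obtained from $(a_1^*-1,a_2^*,\dots,a_{k-1}^*)$ by ordering it non-increasingly; (iii) if $m^*=0$ and $a_1^*\le a_k^*+1$, then $k^+=k+1$.
   Context: $t_s(n)$ is the number of edges of the Turán graph $T_s(n)$; $k(n,e):=\min\{s\in\mathbb{N}:e\le t_s(n)\}$. For $k=k(n,e)$, $\bm a^*(n,e)=(a_1^*,\dots,a_k^*)$ is defined by $a_k^*:=\min\{a\in\mathbb{N}:a(n-a)+t_{k-1}(n-a)\ge e\}$ and $a_1^*+\dots+a_{k-1}^*=n-a_k^*$, $a_1^*\ge\dots\ge a_{k-1}^*\ge a_1^*-1$; and $m^*(n,e):=\sum_{1\le i<j\le k}a_i^*a_j^*-e$. -}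

module Defs where

open import Data.Nat using (ℕ; zero; suc; _+_; _*_; _∸_; _≤_; _<_)
open import Data.Nat.DivMod using (_/_; _%_)
open import Data.Nat.Combinatorics using (_C_)
open import Data.List using (List; []; _∷_; length; _++_)
open import Data.Nat.ListAction using (sum)
open import Data.List.Relation.Unary.All using (All)
open import Data.List.Relation.Unary.Linked using (Linked)
open import Data.Product using (_×_)
open import Relation.Binary.PropositionalEquality using (_≡_)
open import Relation.Nullary using (¬_)

-- Number of edges of the Turán graph T_s(n) (complete s-partite graph on n
-- vertices with parts as equal as possible): with n = q*s + r (0 ≤ r < s),
-- there are r parts of size q+1 and s-r parts of size q, so
-- t_s(n) = C(n,2) - r*C(q+1,2) - (s-r)*C(q,2).  (s = 0 is never used
-- for k, since k ranges over s ≥ 1; we set t_0(n) = 0 as a dummy.)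
t : ℕ → ℕ → ℕ
t zero n = 0
t (suc s) n =
  (n C 2) ∸ (n % suc s) * (suc (n / suc s) C 2)
          ∸ (suc s ∸ n % suc s) * ((n / suc s) C 2)

IsK : ℕ → ℕ → ℕ → Set
IsK n e k = (1 ≤ k) × (e ≤ t k n) × (∀ s → 1 ≤ s → s < k → ¬ (e ≤ t s n))

-- The condition defining a_k^*: a ≤ n and a(n-a) + t_{k-1}(n-a) ≥ e.
-- For k = 1 the graph T_0(m) exists only for m = 0 (t_0(m) = -∞ for m > 0),
-- so we additionally require n - a = 0 when k = 1.
AkCond : ℕ → ℕ → ℕ → ℕ → Set
AkCond n e k a =
  (a ≤ n) × (e ≤ a * (n ∸ a) + t (k ∸ 1) (n ∸ a)) × (k ≡ 1 → n ∸ a ≡ 0)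

hd : List ℕ → ℕ
hd [] = 0
hd (x ∷ _) = x

-- a^*(n,e) with k = k(n,e) is represented as  as ++ (ak ∷ []),
-- where as = (a_1^*, …, a_{k-1}^*) and ak = a_k^*.
IsAstar : ℕ → ℕ → ℕ → List ℕ → ℕ → Set
IsAstar n e k as ak =
  (length as + 1 ≡ k) ×
  AkCond n e k ak × (∀ a → AkCond n e k a → ak ≤ a) ×
  (sum as + ak ≡ n) ×
  Linked (λ x y → y ≤ x) as ×
  All (λ x → hd as ≤ x + 1) as             -- a_{k-1} ≥ a_1 - 1

pairSum : List ℕ → ℕ
pairSum [] = 0
pairSum (x ∷ xs) = x * sum xs + pairSum xs

module Submission where

-- A k-partition of n with part sizes l (a list of length k, sum n) spans
-- pairSum l = Σ_{i<j} l_i l_j edges; the Turán number t k n is the maximum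
-- of pairSum over such partitions and is attained exactly by balanced ones
-- (all parts in {c, c+1}).

open import Defs
open import Data.Nat using (ℕ; zero; suc; _+_; _*_; _∸_; _≤_; _<_; z≤n; s≤s; z<s; _≤?_)
open import Data.Nat.Properties
open import Data.Nat.Combinatorics using (_C_; nCk+nC[k+1]≡[n+1]C[k+1]; nC1≡n)
open import Data.Nat.DivMod using (_/_; _%_; m≡m%n+[m/n]*n; m%n<n)
open import Data.Nat.ListAction using (sum)
open import Data.Nat.ListAction.Properties using (sum-++; sum-↭)
open import Data.Nat.Tactic.RingSolver using (solve-∀)
open import Data.List using (List; []; _∷_; _++_; length; replicate)
open import Data.List.Properties using (length-++; length-replicate)
open import Data.List.Relation.Unary.All as All using (All; []; _∷_)
import Data.List.Relation.Unary.All.Properties as All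
open import Data.List.Relation.Unary.Linked as Linked using (Linked; []; [-]; _∷_)
open import Data.List.Relation.Unary.Linked.Properties using (Linked⇒All)
open import Data.List.Relation.Binary.Permutation.Propositional using (_↭_; ↭-sym)
open import Data.List.Relation.Binary.Permutation.Propositional.Properties using (All-resp-↭; ↭-length)
open import Relation.Binary.Properties.DecTotalOrder ≤-decTotalOrder using (≥-decTotalOrder)
open import Data.List.Sort ≥-decTotalOrder using (sort; sort-↭; sort-↗)
open import Data.Product using (_×_; _,_; proj₁; proj₂)
open import Data.Empty using (⊥-elim)
open import Relation.Nullary using (yes; no; ¬_)
open import Relation.Binary using (tri<; tri≈; tri>)
open import Relation.Binary.PropositionalEquality

sumSq : List ℕ → ℕ
sumSq [] = 0
sumSq (x ∷ xs) = x * x + sumSq xs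

sumChoose2 : List ℕ → ℕ
sumChoose2 [] = 0
sumChoose2 (x ∷ xs) = x C 2 + sumChoose2 xs

pairSum-square : ∀ l → 2 * pairSum l + sumSq l ≡ sum l * sum l
pairSum-square [] = refl
pairSum-square (x ∷ xs) = begin
  2 * (x * S + pairSum xs) + (x * x + sumSq xs)   ≡⟨ regroup x S (pairSum xs) (sumSq xs) ⟩
  2 * x * S + x * x + (2 * pairSum xs + sumSq xs) ≡⟨ cong (2 * x * S + x * x +_) (pairSum-square xs) ⟩
  2 * x * S + x * x + S * S                       ≡⟨ square x S ⟩
  (x + S) * (x + S)                               ∎
  where
  open ≡-Reasoning
  S : ℕ
  S = sum xs
  regroup : ∀ x S P q → 2 * (x * S + P) + (x * x + q) ≡ 2 * x * S + x * x + (2 * P + q)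
  regroup = solve-∀
  square : ∀ x S → 2 * x * S + x * x + S * S ≡ (x + S) * (x + S)
  square = solve-∀

choose2-suc : ∀ n → suc n C 2 ≡ n + n C 2
choose2-suc n = trans (sym (nCk+nC[k+1]≡[n+1]C[k+1] n 1)) (cong (_+ n C 2) (nC1≡n n))

-- Edges of K_{a+b}: those inside each side plus the a·b crossing ones.
choose2-+ : ∀ a b → (a + b) C 2 ≡ a * b + a C 2 + b C 2
choose2-+ zero b = refl
choose2-+ (suc a) b = begin
  suc (a + b) C 2                   ≡⟨ choose2-suc (a + b) ⟩
  a + b + (a + b) C 2               ≡⟨ cong (a + b +_) (choose2-+ a b) ⟩
  a + b + (a * b + a C 2 + b C 2)   ≡⟨ regroup a b (a C 2) (b C 2) ⟩
  b + a * b + (a + a C 2) + b C 2   ≡⟨ cong (λ z → b + a * b + z + b C 2) (sym (choose2-suc a)) ⟩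
  b + a * b + suc a C 2 + b C 2     ∎
  where
  open ≡-Reasoning
  regroup : ∀ a b x y → a + b + (a * b + x + y) ≡ b + a * b + (a + x) + y
  regroup = solve-∀

-- Edges of K_n split into crossing edges of the partition and edges inside parts.
choose2-sum : ∀ l → sum l C 2 ≡ pairSum l + sumChoose2 l
choose2-sum [] = refl
choose2-sum (x ∷ xs) = begin
  (x + sum xs) C 2                                    ≡⟨ choose2-+ x (sum xs) ⟩
  x * sum xs + x C 2 + sum xs C 2                     ≡⟨ cong (x * sum xs + x C 2 +_) (choose2-sum xs) ⟩
  x * sum xs + x C 2 + (pairSum xs + sumChoose2 xs)   ≡⟨ regroup (x * sum xs) (x C 2) (pairSum xs) (sumChoose2 xs) ⟩
  x * sum xs + pairSum xs + (x C 2 + sumChoose2 xs)   ∎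
  where
  open ≡-Reasoning
  regroup : ∀ a b p q → a + b + (p + q) ≡ a + p + (b + q)
  regroup = solve-∀

length-snoc : ∀ (l : List ℕ) a → length (l ++ a ∷ []) ≡ length l + 1
length-snoc l a = length-++ l

sum-snoc : ∀ l a → sum (l ++ a ∷ []) ≡ sum l + a
sum-snoc l a = trans (sum-++ l (a ∷ [])) (cong (sum l +_) (+-identityʳ a))

pairSum-snoc : ∀ l a → pairSum (l ++ a ∷ []) ≡ pairSum l + a * sum l
pairSum-snoc [] a = +-comm (a * 0) 0
pairSum-snoc (x ∷ xs) a = begin
  x * sum (xs ++ a ∷ []) + pairSum (xs ++ a ∷ []) ≡⟨ cong₂ (λ u v → x * u + v) (sum-snoc xs a) (pairSum-snoc xs a) ⟩
  x * (sum xs + a) + (pairSum xs + a * sum xs)    ≡⟨ regroup x (sum xs) (pairSum xs) a ⟩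
  x * sum xs + pairSum xs + a * (x + sum xs)      ∎
  where
  open ≡-Reasoning
  regroup : ∀ x S P a → x * (S + a) + (P + a * S) ≡ x * S + P + a * (x + S)
  regroup = solve-∀

-- Moving one vertex from a first part of size x+1 to a last part of size a
-- changes the number of crossing edges by x − a.
pairSum-moveVertex : ∀ x a xs →
  pairSum ((suc x ∷ xs) ++ a ∷ []) + x ≡ pairSum ((x ∷ xs) ++ suc a ∷ []) + a
pairSum-moveVertex x a xs = begin
  suc x * sum (xs ++ a ∷ []) + pairSum (xs ++ a ∷ []) + x
    ≡⟨ cong₂ (λ u v → suc x * u + v + x) (sum-snoc xs a) (pairSum-snoc xs a) ⟩
  suc x * (S + a) + (pairSum xs + a * S) + x
    ≡⟨ exchange x a S (pairSum xs) ⟩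
  x * (S + suc a) + (pairSum xs + suc a * S) + a
    ≡⟨ sym (cong₂ (λ u v → x * u + v + a) (sum-snoc xs (suc a)) (pairSum-snoc xs (suc a))) ⟩
  x * sum (xs ++ suc a ∷ []) + pairSum (xs ++ suc a ∷ []) + a ∎
  where
  open ≡-Reasoning
  S : ℕ
  S = sum xs
  exchange : ∀ x a S p → (1 + x) * (S + a) + (p + a * S) + x ≡ x * (S + (1 + a)) + (p + (1 + a) * S) + a
  exchange = solve-∀

sum-moveVertex : ∀ x a xs → sum (suc x ∷ xs) + a ≡ sum (x ∷ xs) + suc a
sum-moveVertex x a xs = sym (+-suc (x + sum xs) a)

Balanced : ℕ → List ℕ → Set
Balanced c = All (λ x → c ≤ x × x ≤ suc c)

-- x² + c(c+1) ≥ (2c+1) x, i.e. (x − c)(x − c − 1) ≥ 0.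
square-bound : ∀ c x → (c + suc c) * x ≤ x * x + c * suc c
square-bound c x with x ≤? c
... | yes x≤c with m≤n⇒∃[o]m+o≡n x≤c
...   | d , refl = subst ((x + d + suc (x + d)) * x ≤_) (sym (expand x d)) (m≤m+n _ _)
  where
  expand : ∀ x d → x * x + (x + d) * (1 + (x + d)) ≡ (x + d + (1 + (x + d))) * x + d * (1 + d)
  expand = solve-∀
square-bound c x | no x≰c with m≤n⇒∃[o]m+o≡n (≰⇒> x≰c)
...   | d , refl = subst ((c + suc c) * (suc c + d) ≤_) (sym (expand c d)) (m≤m+n _ _)
  where
  expand : ∀ c d → (1 + c + d) * (1 + c + d) + c * (1 + c) ≡ (c + (1 + c)) * (1 + c + d) + d * (1 + d)
  expand = solve-∀

square-bound-tight : ∀ c x → c ≤ x → x ≤ suc c → (c + suc c) * x ≡ x * x + c * suc c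
square-bound-tight c x c≤x x≤1+c with x ≟ c
... | yes refl = atLower x
  where
  atLower : ∀ c → (c + (1 + c)) * c ≡ c * c + c * (1 + c)
  atLower = solve-∀
... | no x≢c with ≤-antisym x≤1+c (≤∧≢⇒< c≤x (λ c≡x → x≢c (sym c≡x)))
...   | refl = atUpper c
  where
  atUpper : ∀ c → (c + (1 + c)) * (1 + c) ≡ (1 + c) * (1 + c) + c * (1 + c)
  atUpper = solve-∀

regroup-length : ∀ a K b L → a + K + (b + L * K) ≡ a + b + (1 + L) * K
regroup-length = solve-∀

sumSq-bound : ∀ c l → (c + suc c) * sum l ≤ sumSq l + length l * (c * suc c)
sumSq-bound c [] = ≤-reflexive (*-zeroʳ (c + suc c))
sumSq-bound c (x ∷ xs) = begin
  (c + suc c) * (x + sum xs)                                  ≡⟨ *-distribˡ-+ (c + suc c) x (sum xs) ⟩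
  (c + suc c) * x + (c + suc c) * sum xs                      ≤⟨ +-mono-≤ (square-bound c x) (sumSq-bound c xs) ⟩
  x * x + c * suc c + (sumSq xs + length xs * (c * suc c))    ≡⟨ regroup-length (x * x) (c * suc c) (sumSq xs) (length xs) ⟩
  x * x + sumSq xs + suc (length xs) * (c * suc c)            ∎
  where open ≤-Reasoning

sumSq-bound-tight : ∀ c l → Balanced c l → (c + suc c) * sum l ≡ sumSq l + length l * (c * suc c)
sumSq-bound-tight c [] [] = *-zeroʳ (c + suc c)
sumSq-bound-tight c (x ∷ xs) ((c≤x , x≤1+c) ∷ bal) = begin
  (c + suc c) * (x + sum xs)                                  ≡⟨ *-distribˡ-+ (c + suc c) x (sum xs) ⟩
  (c + suc c) * x + (c + suc c) * sum xs                      ≡⟨ cong₂ _+_ (square-bound-tight c x c≤x x≤1+c) (sumSq-bound-tight c xs bal) ⟩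
  x * x + c * suc c + (sumSq xs + length xs * (c * suc c))    ≡⟨ regroup-length (x * x) (c * suc c) (sumSq xs) (length xs) ⟩
  x * x + sumSq xs + suc (length xs) * (c * suc c)            ∎
  where open ≡-Reasoning

-- Among lists with the same length and sum, a balanced one has the fewest
-- Σ x², hence (by pairSum-square) the most crossing pairs.
balanced-maximises : ∀ c l m → length l ≡ length m → sum l ≡ sum m → Balanced c m →
                     pairSum l ≤ pairSum m
balanced-maximises c l m len≡ sum≡ bal = *-cancelˡ-≤ 2 (+-cancelʳ-≤ (sumSq l) _ _ (begin
  2 * pairSum l + sumSq l   ≡⟨ pairSum-square l ⟩
  sum l * sum l             ≡⟨ cong₂ _*_ sum≡ sum≡ ⟩
  sum m * sum m             ≡⟨ sym (pairSum-square m) ⟩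
  2 * pairSum m + sumSq m   ≤⟨ +-monoʳ-≤ (2 * pairSum m) sumSq≤ ⟩
  2 * pairSum m + sumSq l   ∎))
  where
  open ≤-Reasoning
  K : ℕ
  K = c * suc c
  sumSq≤ : sumSq m ≤ sumSq l
  sumSq≤ = +-cancelʳ-≤ (length m * K) _ _ (begin
    sumSq m + length m * K      ≡⟨ sym (sumSq-bound-tight c m bal) ⟩
    (c + suc c) * sum m         ≡⟨ cong ((c + suc c) *_) (sym sum≡) ⟩
    (c + suc c) * sum l         ≤⟨ sumSq-bound c l ⟩
    sumSq l + length l * K      ≡⟨ cong (λ L → sumSq l + L * K) len≡ ⟩
    sumSq l + length m * K      ∎)

turanParts : ℕ → ℕ → List ℕ
turanParts s m = replicate (m % suc s) (suc (m / suc s)) ++ replicate (suc s ∸ m % suc s) (m / suc s)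

sum-replicate : ∀ a x → sum (replicate a x) ≡ a * x
sum-replicate zero x = refl
sum-replicate (suc a) x = cong (x +_) (sum-replicate a x)

sumChoose2-replicate : ∀ a x → sumChoose2 (replicate a x) ≡ a * (x C 2)
sumChoose2-replicate zero x = refl
sumChoose2-replicate (suc a) x = cong (x C 2 +_) (sumChoose2-replicate a x)

sumChoose2-++ : ∀ l l′ → sumChoose2 (l ++ l′) ≡ sumChoose2 l + sumChoose2 l′
sumChoose2-++ [] l′ = refl
sumChoose2-++ (x ∷ l) l′ = trans (cong (x C 2 +_) (sumChoose2-++ l l′)) (sym (+-assoc (x C 2) _ _))

balanced-replicate : ∀ a {c x} → c ≤ x → x ≤ suc c → Balanced c (replicate a x)
balanced-replicate zero c≤x x≤1+c = []
balanced-replicate (suc a) c≤x x≤1+c = (c≤x , x≤1+c) ∷ balanced-replicate a c≤x x≤1+c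

module _ (s m : ℕ) where
  private
    q : ℕ
    q = m / suc s
    r : ℕ
    r = m % suc s
    r≤1+s : r ≤ suc s
    r≤1+s = <⇒≤ (m%n<n m (suc s))

  length-turanParts : length (turanParts s m) ≡ suc s
  length-turanParts = begin
    length (replicate r (suc q) ++ replicate (suc s ∸ r) q)          ≡⟨ length-++ (replicate r (suc q)) ⟩
    length (replicate r (suc q)) + length (replicate (suc s ∸ r) q)  ≡⟨ cong₂ _+_ (length-replicate r) (length-replicate (suc s ∸ r)) ⟩
    r + (suc s ∸ r)                                                  ≡⟨ m+[n∸m]≡n r≤1+s ⟩
    suc s                                                            ∎
    where open ≡-Reasoning

  sum-turanParts : sum (turanParts s m) ≡ m
  sum-turanParts = begin
    sum (replicate r (suc q) ++ replicate (suc s ∸ r) q)        ≡⟨ sum-++ (replicate r (suc q)) _ ⟩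
    sum (replicate r (suc q)) + sum (replicate (suc s ∸ r) q)   ≡⟨ cong₂ _+_ (sum-replicate r (suc q)) (sum-replicate (suc s ∸ r) q) ⟩
    r * suc q + (suc s ∸ r) * q                                 ≡⟨ regroup r (suc s ∸ r) q ⟩
    r + (r + (suc s ∸ r)) * q                                   ≡⟨ cong (λ z → r + z * q) (m+[n∸m]≡n r≤1+s) ⟩
    r + suc s * q                                               ≡⟨ cong (r +_) (*-comm (suc s) q) ⟩
    r + q * suc s                                               ≡⟨ sym (m≡m%n+[m/n]*n m (suc s)) ⟩
    m                                                           ∎
    where
    open ≡-Reasoning
    regroup : ∀ r r′ q → r * (1 + q) + r′ * q ≡ r + (r + r′) * q
    regroup = solve-∀

  turanParts-balanced : Balanced q (turanParts s m)
  turanParts-balanced = All.++⁺ (balanced-replicate r (n≤1+n q) ≤-refl)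
                                (balanced-replicate (suc s ∸ r) ≤-refl (n≤1+n q))

  pairSum-turanParts : pairSum (turanParts s m) ≡ t (suc s) m
  pairSum-turanParts = sym (begin
    m C 2 ∸ X ∸ Y                     ≡⟨ cong (λ z → z C 2 ∸ X ∸ Y) (sym sum-turanParts) ⟩
    sum T C 2 ∸ X ∸ Y                 ≡⟨ cong (λ z → z ∸ X ∸ Y) (choose2-sum T) ⟩
    pairSum T + sumChoose2 T ∸ X ∸ Y  ≡⟨ cong (λ z → pairSum T + z ∸ X ∸ Y) sumChoose2-T ⟩
    pairSum T + (X + Y) ∸ X ∸ Y       ≡⟨ ∸-+-assoc (pairSum T + (X + Y)) X Y ⟩
    pairSum T + (X + Y) ∸ (X + Y)     ≡⟨ m+n∸n≡m (pairSum T) (X + Y) ⟩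
    pairSum T                         ∎)
    where
    open ≡-Reasoning
    T : List ℕ
    T = turanParts s m
    X : ℕ
    X = r * (suc q C 2)
    Y : ℕ
    Y = (suc s ∸ r) * (q C 2)
    sumChoose2-T : sumChoose2 T ≡ X + Y
    sumChoose2-T = trans (sumChoose2-++ (replicate r (suc q)) _)
      (cong₂ _+_ (sumChoose2-replicate r (suc q)) (sumChoose2-replicate (suc s ∸ r) q))

pairSum≤turan : ∀ l → pairSum l ≤ t (length l) (sum l)
pairSum≤turan [] = z≤n
pairSum≤turan l@(_ ∷ xs) = begin
  pairSum l     ≤⟨ balanced-maximises _ l T (sym (length-turanParts s (sum l)))
                                           (sym (sum-turanParts s (sum l)))
                                           (turanParts-balanced s (sum l)) ⟩
  pairSum T     ≡⟨ pairSum-turanParts s (sum l) ⟩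
  t (suc s) (sum l) ∎
  where
  open ≤-Reasoning
  s : ℕ
  s = length xs
  T : List ℕ
  T = turanParts s (sum l)

balanced⇒turan : ∀ c l → Balanced c l → pairSum l ≡ t (length l) (sum l)
balanced⇒turan c [] [] = refl
balanced⇒turan c l@(_ ∷ xs) bal = ≤-antisym (pairSum≤turan l) (begin
  t (suc s) (sum l) ≡⟨ sym (pairSum-turanParts s (sum l)) ⟩
  pairSum T         ≤⟨ balanced-maximises c T l (length-turanParts s (sum l)) (sum-turanParts s (sum l)) bal ⟩
  pairSum l         ∎)
  where
  open ≤-Reasoning
  s : ℕ
  s = length xs
  T : List ℕ
  T = turanParts s (sum l)

Descending : List ℕ → Set
Descending = Linked (λ x y → y ≤ x)

NearlyEqual : List ℕ → Set
NearlyEqual l = All (λ y → hd l ≤ y + 1) l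

descending-≤head : ∀ {x xs} → Descending (x ∷ xs) → All (_≤ x) (x ∷ xs)
descending-≤head = Linked⇒All {R = λ a b → b ≤ a} (λ p q → ≤-trans q p) ≤-refl

nearlyEqual-tail : ∀ {x xs} → Descending (x ∷ xs) → NearlyEqual (x ∷ xs) → NearlyEqual xs
nearlyEqual-tail [-] _ = []
nearlyEqual-tail (y≤x ∷ _) (_ ∷ near) = All.map (≤-trans y≤x) near

≤pred⇒≤+1 : ∀ x → x ≤ suc (x ∸ 1)
≤pred⇒≤+1 zero = z≤n
≤pred⇒≤+1 (suc x) = ≤-refl

pred≤ : ∀ {x y} → x ≤ y + 1 → x ∸ 1 ≤ y
pred≤ {x} {y} x≤y+1 = ≤-trans (∸-monoˡ-≤ 1 x≤y+1) (≤-reflexive (m+n∸n≡m y 1))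

nearlyEqual⇒balanced : ∀ {x xs} → Descending (x ∷ xs) → NearlyEqual (x ∷ xs) → Balanced (x ∸ 1) (x ∷ xs)
nearlyEqual⇒balanced {x} desc near =
  All.zipWith (λ (x≤y+1 , y≤x) → pred≤ x≤y+1 , ≤-trans y≤x (≤pred⇒≤+1 x)) (near , descending-≤head desc)

balanced⇒nearlyEqual : ∀ {c} l → Balanced c l → NearlyEqual l
balanced⇒nearlyEqual [] [] = []
balanced⇒nearlyEqual (x ∷ xs) bal@((_ , x≤1+c) ∷ _) =
  All.map (λ {y} (c≤y , _) → ≤-trans x≤1+c (≤-trans (s≤s c≤y) (≤-reflexive (+-comm 1 y)))) bal

smaller-head⇒smaller-sum : ∀ {x y xs ys} → x < y → Descending (x ∷ xs) → NearlyEqual (y ∷ ys) →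
                           length xs ≡ length ys → sum (x ∷ xs) < sum (y ∷ ys)
smaller-head⇒smaller-sum {x} {y} {xs} {ys} x<y desc near len≡ =
  +-mono-<-≤ x<y (≤-trans (sum≤ xs (All.tail (descending-≤head desc)))
                           (subst (λ L → L * x ≤ sum ys) (sym len≡) (≤sum ys (All.map x≤ (All.tail near)))))
  where
  x≤ : ∀ {z} → y ≤ z + 1 → x ≤ z
  x≤ {z} y≤z+1 = ≤-pred (≤-trans x<y (≤-trans y≤z+1 (≤-reflexive (+-comm z 1))))
  sum≤ : ∀ l → All (_≤ x) l → sum l ≤ length l * x
  sum≤ [] [] = z≤n
  sum≤ (_ ∷ l) (p ∷ ps) = +-mono-≤ p (sum≤ l ps)
  ≤sum : ∀ l → All (x ≤_) l → length l * x ≤ sum l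
  ≤sum [] [] = z≤n
  ≤sum (_ ∷ l) (p ∷ ps) = +-mono-≤ p (≤sum l ps)

nearlyEqual-unique : ∀ l m → Descending l → Descending m → NearlyEqual l → NearlyEqual m →
                     length l ≡ length m → sum l ≡ sum m → l ≡ m
nearlyEqual-unique [] [] _ _ _ _ _ _ = refl
nearlyEqual-unique (x ∷ xs) (y ∷ ys) dl dm nl nm len≡ sum≡ with <-cmp x y
... | tri< x<y _ _ = ⊥-elim (<-irrefl sum≡ (smaller-head⇒smaller-sum x<y dl nm (suc-injective len≡)))
... | tri> _ _ y<x = ⊥-elim (<-irrefl (sym sum≡) (smaller-head⇒smaller-sum y<x dm nl (sym (suc-injective len≡))))
... | tri≈ _ refl _ = cong (x ∷_) (nearlyEqual-unique xs ys (Linked.tail dl) (Linked.tail dm)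
                        (nearlyEqual-tail dl nl) (nearlyEqual-tail dm nm) (suc-injective len≡) (+-cancelˡ-≡ x _ _ sum≡))

k-least : ∀ {n e k s} → IsK n e k → 1 ≤ s → e ≤ t s n → k ≤ s
k-least {s = s} (_ , _ , minimal) 1≤s e≤t = ≮⇒≥ (λ s<k → minimal s 1≤s s<k e≤t)

k-monotone : ∀ {n e k k⁺} → IsK n e k → IsK n (suc e) k⁺ → k ≤ k⁺
k-monotone K (1≤k⁺ , e+1≤t , _) = k-least K 1≤k⁺ (≤-trans (n≤1+n _) e+1≤t)

k-stays : ∀ {n e k k⁺} → IsK n e k → IsK n (suc e) k⁺ → suc e ≤ t k n → k⁺ ≡ k
k-stays K K⁺ e+1≤t = ≤-antisym (k-least K⁺ (proj₁ K) e+1≤t) (k-monotone K K⁺)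

k-jumps : ∀ {n e k k⁺} → IsK n e k → IsK n (suc e) k⁺ → t k n ≡ e → suc e ≤ t (suc k) n → k⁺ ≡ suc k
k-jumps {e = e} {k} {k⁺} K K⁺@(_ , e+1≤t , _) t≡e e+1≤t′ =
  ≤-antisym (k-least K⁺ (s≤s z≤n) e+1≤t′) (≤∧≢⇒< (k-monotone K K⁺) k≢k⁺)
  where
  k≢k⁺ : k ≢ k⁺
  k≢k⁺ refl = <-irrefl refl (subst (suc e ≤_) t≡e e+1≤t)

module _ {n e k : ℕ} {as : List ℕ} {ak : ℕ} (A : IsAstar n e k as ak) where
  astar-length : length as + 1 ≡ k
  astar-length = proj₁ A

  astar-cond : AkCond n e k ak
  astar-cond = proj₁ (proj₂ A)

  astar-minimal : ∀ a → AkCond n e k a → ak ≤ a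
  astar-minimal = proj₁ (proj₂ (proj₂ A))

  astar-sum : sum as + ak ≡ n
  astar-sum = proj₁ (proj₂ (proj₂ (proj₂ A)))

  astar-descending : Descending as
  astar-descending = proj₁ (proj₂ (proj₂ (proj₂ (proj₂ A))))

  astar-nearlyEqual : NearlyEqual as
  astar-nearlyEqual = proj₂ (proj₂ (proj₂ (proj₂ (proj₂ A))))

akCond-weaken : ∀ {n e k a} → AkCond n (suc e) k a → AkCond n e k a
akCond-weaken (a≤n , e+1≤ , k≡1⇒) = a≤n , ≤-trans (n≤1+n _) e+1≤ , k≡1⇒

akCond-witness : ∀ {n e k a} l → length l + 1 ≡ k → sum l + a ≡ n → e ≤ pairSum (l ++ a ∷ []) → AkCond n e k a
akCond-witness {e = e} {a = a} l refl refl e≤ =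
  m≤n+m a (sum l) , e≤bound , rest-empty l
  where
  open ≤-Reasoning
  e≤bound : e ≤ a * (sum l + a ∸ a) + t (length l + 1 ∸ 1) (sum l + a ∸ a)
  e≤bound = begin
    e                                  ≤⟨ e≤ ⟩
    pairSum (l ++ a ∷ [])              ≡⟨ pairSum-snoc l a ⟩
    pairSum l + a * sum l              ≤⟨ +-monoˡ-≤ (a * sum l) (pairSum≤turan l) ⟩
    t (length l) (sum l) + a * sum l   ≡⟨ +-comm _ (a * sum l) ⟩
    a * sum l + t (length l) (sum l)   ≡⟨ sym (cong₂ (λ m L → a * m + t L m) (m+n∸n≡m (sum l) a) (m+n∸n≡m (length l) 1)) ⟩
    a * (sum l + a ∸ a) + t (length l + 1 ∸ 1) (sum l + a ∸ a) ∎
  rest-empty : ∀ l′ → length l′ + 1 ≡ 1 → sum l′ + a ∸ a ≡ 0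
  rest-empty [] _ = n∸n≡0 a
  rest-empty (_ ∷ l′) eq with m+n≡0⇒n≡0 (length l′) (suc-injective eq)
  ... | ()

-- The quantity bounded below by e in the definition of a_k^* never exceeds
-- t k n: it counts the edges of the k-partition formed by a part of size a
-- and the Turán partition of the remaining n − a vertices into k − 1 parts.
akCond⇒turan : ∀ {n e k a} → 1 ≤ k → AkCond n e k a → e ≤ t k n
akCond⇒turan {n} {e} {suc zero} {a} _ (_ , e≤ , k≡1⇒) =
  ≤-trans (subst (e ≤_) no-edges e≤) z≤n
  where
  no-edges : a * (n ∸ a) + 0 ≡ 0
  no-edges = trans (+-identityʳ _) (trans (cong (a *_) (k≡1⇒ refl)) (*-zeroʳ a))
akCond⇒turan {n} {e} {suc (suc s)} {a} _ (a≤n , e≤ , _) = begin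
  e                                         ≤⟨ e≤ ⟩
  a * (n ∸ a) + t (suc s) (n ∸ a)           ≡⟨ sym (cong₂ (λ m p → a * m + p) (sum-turanParts s (n ∸ a)) (pairSum-turanParts s (n ∸ a))) ⟩
  a * sum T + pairSum T                     ≡⟨ trans (+-comm _ (pairSum T)) (sym (pairSum-snoc T a)) ⟩
  pairSum (T ++ a ∷ [])                     ≤⟨ pairSum≤turan (T ++ a ∷ []) ⟩
  t (length (T ++ a ∷ [])) (sum (T ++ a ∷ [])) ≡⟨ cong₂ t length≡ sum≡ ⟩
  t (suc (suc s)) n                         ∎
  where
  open ≤-Reasoning
  T : List ℕ
  T = turanParts s (n ∸ a)
  length≡ : length (T ++ a ∷ []) ≡ suc (suc s)
  length≡ = trans (length-snoc T a) (trans (cong (_+ 1) (length-turanParts s (n ∸ a))) (+-comm (suc s) 1))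
  sum≡ : sum (T ++ a ∷ []) ≡ n
  sum≡ = trans (sum-snoc T a) (trans (cong (_+ a) (sum-turanParts s (n ∸ a))) (m∸n+n≡m a≤n))

descending-nearlyEqual⇒turan : ∀ l → Descending l → NearlyEqual l → pairSum l ≡ t (length l) (sum l)
descending-nearlyEqual⇒turan [] _ _ = refl
descending-nearlyEqual⇒turan (x ∷ xs) desc near = balanced⇒turan (x ∸ 1) (x ∷ xs) (nearlyEqual⇒balanced desc near)

astar-pairSum : ∀ {n e k as ak} → IsAstar n e k as ak →
                pairSum (as ++ ak ∷ []) ≡ ak * (n ∸ ak) + t (k ∸ 1) (n ∸ ak)
astar-pairSum {as = as} {ak} A@(refl , _ , _ , refl , _ , _) = begin
  pairSum (as ++ ak ∷ [])                 ≡⟨ pairSum-snoc as ak ⟩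
  pairSum as + ak * sum as                ≡⟨ +-comm (pairSum as) _ ⟩
  ak * sum as + pairSum as                ≡⟨ cong (ak * sum as +_) (descending-nearlyEqual⇒turan as (astar-descending A) (astar-nearlyEqual A)) ⟩
  ak * sum as + t (length as) (sum as)    ≡⟨ sym (cong₂ (λ m L → ak * m + t L m) (m+n∸n≡m (sum as) ak) (m+n∸n≡m (length as) 1)) ⟩
  ak * (sum as + ak ∸ ak) + t (length as + 1 ∸ 1) (sum as + ak ∸ ak) ∎
  where open ≡-Reasoning

astar-covers : ∀ {n e k as ak} → IsAstar n e k as ak → e ≤ pairSum (as ++ ak ∷ [])
astar-covers A = subst (_ ≤_) (sym (astar-pairSum A)) (proj₁ (proj₂ (astar-cond A)))

balance-≤ : ∀ {p q x y} → p + x ≡ q + y → y ≤ x → p ≤ q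
balance-≤ {p} {q} {x} {y} eq y≤x = +-cancelʳ-≤ x p q (≤-trans (≤-reflexive eq) (+-monoʳ-≤ q y≤x))

balance-< : ∀ {p q x y} → p + x ≡ q + y → y < x → p < q
balance-< {p} {q} {x} {y} eq y<x = +-cancelʳ-< x p q (≤-trans (≤-reflexive (cong suc eq)) (+-monoʳ-< q y<x))

-- The last part of a^* is not larger than the first: otherwise moving a
-- vertex from it to the first part would certify a smaller a_k.
astar-last≤first : ∀ {n e k h xs ak} → IsAstar n e k (h ∷ xs) ak → ak ≤ h
astar-last≤first {ak = zero} A = z≤n
astar-last≤first {n} {e} {k} {h} {xs} {suc a} A with h ≤? a
... | no h≰a = ≰⇒> h≰a
... | yes h≤a = ⊥-elim (n≮n a (astar-minimal A a smaller-a))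
  where
  smaller-a : AkCond n e k a
  smaller-a = akCond-witness (suc h ∷ xs) (astar-length A) (trans (sum-moveVertex h a xs) (astar-sum A))
    (≤-trans (astar-covers A) (balance-≤ (sym (pairSum-moveVertex h a xs)) h≤a))

astar-parts : ∀ {n e k as ak} → IsAstar n e k as ak → length (as ++ ak ∷ []) ≡ k
astar-parts {as = as} {ak} A = trans (length-snoc as ak) (astar-length A)

astar-vertices : ∀ {n e k as ak} → IsAstar n e k as ak → sum (as ++ ak ∷ []) ≡ n
astar-vertices {as = as} {ak} A = trans (sum-snoc as ak) (astar-sum A)

astar-monotone : ∀ {n e k as ak as⁺ ak⁺} → IsAstar n e k as ak → IsAstar n (suc e) k as⁺ ak⁺ → ak ≤ ak⁺
astar-monotone A A⁺ = astar-minimal A _ (akCond-weaken (astar-cond A⁺))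

astar-tight : ∀ {n e k as ak} → IsAstar n e k as ak → pairSum (as ++ ak ∷ []) ≡ e → ¬ AkCond n (suc e) k ak
astar-tight {e = e} A p≡e (_ , e+1≤ , _) = <-irrefl refl (subst (e <_) (trans (sym (astar-pairSum A)) p≡e) e+1≤)

astar-determined : ∀ {n e k as ak} l → IsAstar n e k as ak → Descending l → NearlyEqual l →
                   length l + 1 ≡ k → sum l + ak ≡ n → as ≡ l
astar-determined {ak = ak} l A desc near length≡ sum≡ =
  nearlyEqual-unique _ l (astar-descending A) desc (astar-nearlyEqual A) near
    (+-cancelʳ-≡ 1 _ _ (trans (astar-length A) (sym length≡)))
    (+-cancelʳ-≡ ak _ _ (trans (astar-sum A) (sym sum≡)))

astar-surplus : ∀ {n e k as ak} → IsAstar n e k as ak → e < pairSum (as ++ ak ∷ []) → AkCond n (suc e) k ak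
astar-surplus {as = as} A e<p = akCond-witness as (astar-length A) (astar-sum A) e<p

stays-case : ∀ {n e k k⁺ as ak as⁺ ak⁺} → IsK n e k → IsAstar n e k as ak →
             IsK n (suc e) k⁺ → IsAstar n (suc e) k⁺ as⁺ ak⁺ →
             e < pairSum (as ++ ak ∷ []) → (k⁺ ≡ k) × (as⁺ ≡ as) × (ak⁺ ≡ ak)
stays-case {as = as} {ak} {as⁺} {ak⁺} K A K⁺ A⁺ e<p with k-stays K K⁺ (akCond⇒turan (proj₁ K) (astar-surplus A e<p))
... | refl = refl , sym as≡as⁺ , ak⁺≡ak
  where
  ak⁺≡ak : ak⁺ ≡ ak
  ak⁺≡ak = ≤-antisym (astar-minimal A⁺ ak (astar-surplus A e<p)) (astar-monotone A A⁺)
  as≡as⁺ : as ≡ as⁺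
  as≡as⁺ = astar-determined as⁺ A (astar-descending A⁺) (astar-nearlyEqual A⁺)
             (astar-length A⁺) (trans (cong (sum as⁺ +_) (sym ak⁺≡ak)) (astar-sum A⁺))

-- When a^* spans exactly e edges and its first part exceeds the last by at
-- least two, moving one vertex from the first part to the last gains an edge.
astar-shift : ∀ {n e k h xs a} → IsAstar n e k (suc h ∷ xs) a → pairSum ((suc h ∷ xs) ++ a ∷ []) ≡ e →
              a < h → AkCond n (suc e) k (suc a)
astar-shift {h = h} {xs} {a} A p≡e a<h =
  akCond-witness (h ∷ xs) (astar-length A) (trans (sym (sum-moveVertex h a xs)) (astar-sum A))
    (subst (_< pairSum ((h ∷ xs) ++ suc a ∷ [])) p≡e (balance-< (pairSum-moveVertex h a xs) a<h))

gap⇒< : ∀ {a h} → a + 2 ≤ suc h → a < h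
gap⇒< {a} {h} gap = ≤-pred (subst (_≤ suc h) (+-comm a 2) gap)

shift-case : ∀ {n e k k⁺ as ak as⁺ ak⁺} → IsK n e k → IsAstar n e k as ak →
             IsK n (suc e) k⁺ → IsAstar n (suc e) k⁺ as⁺ ak⁺ →
             pairSum (as ++ ak ∷ []) ≡ e → ak + 2 ≤ hd (as ++ ak ∷ []) →
             (k⁺ ≡ k) × (ak⁺ ≡ ak + 1) ×
             (∀ x xs → as ≡ x ∷ xs → (as⁺ ↭ ((x ∸ 1) ∷ xs)) × Linked (λ u v → v ≤ u) as⁺)
shift-case {as = []} {ak} _ _ _ _ _ gap = ⊥-elim (m+1+n≰m ak gap)
shift-case {as = zero ∷ _} {ak} _ _ _ _ _ gap with subst (_≤ 0) (+-comm ak 2) gap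
... | ()
shift-case {as = suc h ∷ xs} {a} {as⁺} {ak⁺} K A K⁺ A⁺ p≡e gap
  with k-stays K K⁺ (akCond⇒turan (proj₁ K) (astar-shift A p≡e (gap⇒< gap)))
... | refl = refl , trans ak⁺≡1+a (+-comm 1 a) , reordered
  where
  a≢ak⁺ : a ≢ ak⁺
  a≢ak⁺ refl = astar-tight A p≡e (astar-cond A⁺)
  ak⁺≡1+a : ak⁺ ≡ suc a
  ak⁺≡1+a = ≤-antisym (astar-minimal A⁺ (suc a) (astar-shift A p≡e (gap⇒< gap))) (≤∧≢⇒< (astar-monotone A A⁺) a≢ak⁺)
  sorted : List ℕ
  sorted = sort (h ∷ xs)
  balanced : Balanced h (h ∷ xs)
  balanced = (≤-refl , n≤1+n h) ∷ All.tail (nearlyEqual⇒balanced (astar-descending A) (astar-nearlyEqual A))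
  as⁺≡sorted : as⁺ ≡ sorted
  as⁺≡sorted = astar-determined sorted A⁺ (sort-↗ (h ∷ xs))
    (balanced⇒nearlyEqual sorted (All-resp-↭ (↭-sym (sort-↭ (h ∷ xs))) balanced))
    (trans (cong (_+ 1) (↭-length (sort-↭ (h ∷ xs)))) (astar-length A))
    (trans (cong₂ _+_ (sum-↭ (sort-↭ (h ∷ xs))) ak⁺≡1+a) (trans (sym (sum-moveVertex h a xs)) (astar-sum A)))
  reordered : ∀ x ys → suc h ∷ xs ≡ x ∷ ys → (as⁺ ↭ ((x ∸ 1) ∷ ys)) × Linked (λ u v → v ≤ u) as⁺
  reordered _ _ refl = subst (_↭ (h ∷ xs)) (sym as⁺≡sorted) (sort-↭ (h ∷ xs)) , astar-descending A⁺

complete-if-small : ∀ l → All (_≤ 1) l → pairSum l ≡ sum l C 2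
complete-if-small l small = sym (begin
  sum l C 2                   ≡⟨ choose2-sum l ⟩
  pairSum l + sumChoose2 l    ≡⟨ cong (pairSum l +_) (no-inner-edges l small) ⟩
  pairSum l + 0               ≡⟨ +-identityʳ (pairSum l) ⟩
  pairSum l                   ∎)
  where
  open ≡-Reasoning
  no-inner-edges : ∀ l → All (_≤ 1) l → sumChoose2 l ≡ 0
  no-inner-edges [] [] = refl
  no-inner-edges (zero ∷ l) (_ ∷ small) = no-inner-edges l small
  no-inner-edges (suc zero ∷ l) (_ ∷ small) = no-inner-edges l small
  no-inner-edges (suc (suc _) ∷ _) (s≤s () ∷ _)

pairSum-split : ∀ z rest → pairSum (suc (suc z) ∷ rest) + suc z ≡ pairSum (1 ∷ suc z ∷ rest)
pairSum-split z rest = regroup z (sum rest) (pairSum rest)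
  where
  regroup : ∀ z R p → (2 + z) * R + p + (1 + z) ≡ 1 * (1 + z + R) + ((1 + z) * R + p)
  regroup = solve-∀

-- If the head of l is a largest part and l does not span all of K_n, then
-- splitting the head gives a partition into one more part with more edges;
-- hence pairSum l < t (length l + 1) (sum l).
turan-next-exceeds : ∀ l → All (_≤ hd l) l → pairSum l < sum l C 2 → pairSum l < t (suc (length l)) (sum l)
turan-next-exceeds [] _ ()
turan-next-exceeds l@(zero ∷ _) ≤0 incomplete =
  ⊥-elim (<-irrefl (complete-if-small l (All.map (λ x≤0 → ≤-trans x≤0 z≤n) ≤0)) incomplete)
turan-next-exceeds l@(suc zero ∷ _) ≤1 incomplete = ⊥-elim (<-irrefl (complete-if-small l ≤1) incomplete)
turan-next-exceeds (suc (suc z) ∷ rest) _ _ = begin-strict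
  pairSum (suc (suc z) ∷ rest)          <⟨ m<m+n _ z<s ⟩
  pairSum (suc (suc z) ∷ rest) + suc z  ≡⟨ pairSum-split z rest ⟩
  pairSum (1 ∷ suc z ∷ rest)            ≤⟨ pairSum≤turan (1 ∷ suc z ∷ rest) ⟩
  t (suc (suc (length rest))) (suc (suc z) + sum rest) ∎
  where open ≤-Reasoning

astar-flat : ∀ {n e k as ak} → IsAstar n e k as ak → hd (as ++ ak ∷ []) ≤ ak + 1 →
             Balanced (hd (as ++ ak ∷ []) ∸ 1) (as ++ ak ∷ []) × All (_≤ hd (as ++ ak ∷ [])) (as ++ ak ∷ [])
astar-flat {as = []} {ak} _ _ = (m∸n≤m ak 1 , ≤pred⇒≤+1 ak) ∷ [] , ≤-refl ∷ []
astar-flat {as = h ∷ xs} {ak} A flat =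
  All.++⁺ (nearlyEqual⇒balanced desc (astar-nearlyEqual A)) ((pred≤ flat , ≤-trans ak≤h (≤pred⇒≤+1 h)) ∷ []) ,
  All.++⁺ (descending-≤head desc) (ak≤h ∷ [])
  where
  desc : Descending (h ∷ xs)
  desc = astar-descending A
  ak≤h : ak ≤ h
  ak≤h = astar-last≤first A

-- Case (iii): then a^* is a balanced k-partition with exactly e edges, so
-- t k n = e, while t (k+1) n > e; hence k grows by one.
jump-case : ∀ {n e k k⁺ as ak} → IsK n e k → IsAstar n e k as ak → IsK n (suc e) k⁺ →
            e < n C 2 → pairSum (as ++ ak ∷ []) ≡ e → hd (as ++ ak ∷ []) ≤ ak + 1 → k⁺ ≡ suc k
jump-case {n} {e} {k} {as = as} {ak} K A K⁺ e<C p≡e flat = k-jumps K K⁺ t≡e e<t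
  where
  l : List ℕ
  l = as ++ ak ∷ []
  balanced : Balanced (hd l ∸ 1) l
  balanced = proj₁ (astar-flat A flat)
  head-largest : All (_≤ hd l) l
  head-largest = proj₂ (astar-flat A flat)
  t≡e : t k n ≡ e
  t≡e = begin
    t k n                   ≡⟨ sym (cong₂ t (astar-parts A) (astar-vertices A)) ⟩
    t (length l) (sum l)    ≡⟨ sym (balanced⇒turan _ l balanced) ⟩
    pairSum l               ≡⟨ p≡e ⟩
    e                       ∎
    where open ≡-Reasoning
  incomplete : pairSum l < sum l C 2
  incomplete = subst₂ _<_ (sym p≡e) (cong (_C 2) (sym (astar-vertices A))) e<C
  e<t : e < t (suc k) n
  e<t = begin-strict
    e                             ≡⟨ sym p≡e ⟩
    pairSum l                     <⟨ turan-next-exceeds l head-largest incomplete ⟩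
    t (suc (length l)) (sum l)    ≡⟨ cong₂ (λ K m → t (suc K) m) (astar-parts A) (astar-vertices A) ⟩
    t (suc k) n                   ∎
    where open ≤-Reasoning

lemma4p15 : (n e k k⁺ ak ak⁺ : ℕ) (as as⁺ : List ℕ) →
    e < n C 2 →
    IsK n e k → IsAstar n e k as ak →
    IsK n (suc e) k⁺ → IsAstar n (suc e) k⁺ as⁺ ak⁺ →
    (e < pairSum (as ++ ak ∷ []) → (k⁺ ≡ k) × (as⁺ ≡ as) × (ak⁺ ≡ ak))
    × (pairSum (as ++ ak ∷ []) ≡ e → ak + 2 ≤ hd (as ++ ak ∷ []) →
        (k⁺ ≡ k) × (ak⁺ ≡ ak + 1) ×
        (∀ x xs → as ≡ x ∷ xs →
          (as⁺ ↭ ((x ∸ 1) ∷ xs)) × Linked (λ u v → v ≤ u) as⁺))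
    × (pairSum (as ++ ak ∷ []) ≡ e → hd (as ++ ak ∷ []) ≤ ak + 1 →
        k⁺ ≡ suc k)
lemma4p15 n e k k⁺ ak ak⁺ as as⁺ e<C K A K⁺ A⁺ =
  stays-case K A K⁺ A⁺ , shift-case K A K⁺ A⁺ , jump-case K A K⁺ e<C
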